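{- Let $m\in\mathbb{N}$, $e\in\mathrm{E}_m$, and $a,b,c\in\mathrm{R}_m^e$ with $a\in\mathrm{Orb}_m(b)\cap\mathrm{Orb}_m(c)$. Then there exists $d\in\mathrm{R}_m^e$ such that $a\in\mathrm{Orb}_m(d)$ and $|d|_m=[|b|_m,|c|_m]$.
   Context: $\mathbb{N}=\{1,2,\dots\}$, $\mathbb{Z}_m=\{1,\dots,m\}$, $x\bmod m$ denotes the element of $\mathbb{Z}_m$ congruent to $x$, $[u,v]$ is the least common multiple. $\mathrm{E}_m=\{e\in\mathbb{Z}_m: e^2\equiv e\pmod m\}$. For $a\in\mathbb{Z}$, $|a|_m$ is the smallest $n\in\mathbb{N}$ with $a^n\bmod m\in\mathrm{E}_m$. $a\in\mathbb{Z}_m$ is regular if $a^{|a|_m+1}\equiv a\pmod m$; $\mathrm{R}_m$ is the set of regular residues; for $e\in\mathrm{E}_m$, $\mathrm{R}_m^e=\{a\in\mathrm{R}_m: a^{|a|_m}\equiv e\pmod m\}$. The orbit of $a\in\mathbb{Z}_m$ is $\mathrm{Orb}_m(a)=\{a^n\bmod m: 1\le n\le|a|_m\}$. -}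

module Defs where

open import Data.Nat using (ℕ; suc; _*_; _^_; _≤_; _<_; NonZero)
open import Data.Nat.DivMod using (_%_)
open import Data.Product using (_×_; ∃-syntax)
open import Relation.Binary.PropositionalEquality using (_≡_)
open import Relation.Nullary using (¬_)

infix 4 _≡_[mod_]
_≡_[mod_] : ℕ → ℕ → (m : ℕ) → .{{NonZero m}} → Set
x ≡ y [mod m ] = x % m ≡ y % m

InZ : ℕ → ℕ → Set
InZ m a = 1 ≤ a × a ≤ m

InE : (m : ℕ) → .{{NonZero m}} → ℕ → Set
InE m e = InZ m e × (e * e ≡ e [mod m ])

IdemMod : (m : ℕ) → .{{NonZero m}} → ℕ → Set
IdemMod m x = x * x ≡ x [mod m ]

IsIndex : (m : ℕ) → .{{NonZero m}} → ℕ → ℕ → Set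
IsIndex m a n = 1 ≤ n × IdemMod m (a ^ n)
              × (∀ k → 1 ≤ k → k < n → ¬ IdemMod m (a ^ k))

InRe : (m : ℕ) → .{{NonZero m}} → ℕ → ℕ → ℕ → Set
InRe m e a n = InZ m a × IsIndex m a n
             × (a ^ suc n ≡ a [mod m ]) × (a ^ n ≡ e [mod m ])

-- a ∈ Orb_m(b), where nb = |b|_m  (a ∈ ℤ_m, so a = b^k mod m iff a ≡ b^k)
InOrb : (m : ℕ) → .{{NonZero m}} → ℕ → ℕ → ℕ → Set
InOrb m a b nb = ∃[ k ] (1 ≤ k × k ≤ nb × (a ≡ b ^ k [mod m ]))

module Submission where

-- Idea.  x ∈ R_m^e with |x|_m = n says exactly that x lies in the maximal subgroup of
-- (ℤ_m , ·) with identity e and has order n there (the record Order).  Let nb, nc be the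
-- orders of b, c and split lcm nb nc = u * v with coprime u ∣ nb, v ∣ nc (LcmSplit, via the
-- prime factorisation of nb); write nb = s * u, nc = w * v.  Then D = b^s * c^w has order
-- u * v: its powers D^ε₁ = b^s and D^ε₂ = c^w, for the Chinese-remainder idempotents
-- ε₁ ≡ (1 , 0) and ε₂ ≡ (0 , 1) modulo (u , v) (CRT, from Bézout's identity), control
-- which powers of D are e.  For a ≈ b^k ≈ c^j we get a ≈ a^ε₁ * a^ε₂ with a^ε₁ a power of
-- b^s and a^ε₂ a power of c^w, so a is a power of D.  Take d the representative of D in ℤ_m.

open import Defs
open import Data.Nat using (ℕ; NonZero)
open import Data.Nat.LCM using (lcm)
open import Data.Product using (_×_; ∃-syntax)
open import Relation.Binary.PropositionalEquality using (_≡_)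

open import Data.Nat
  using (zero; suc; _+_; _*_; _∸_; _^_; _%_; _/_; _≤_; _<_; z≤n; s≤s; >-nonZero; >-nonZero⁻¹)
open import Data.Nat.Properties
open import Data.Nat.DivMod using (m≡m%n+[m/n]*n; m%n<n; %-distribˡ-*; n%n≡0; m<n⇒m%n≡m)
open import Data.Nat.Divisibility
open import Data.Nat.Coprimality as Coprime using (Coprime; coprime-divisor; coprime-Bézout; coprime⇒gcd≡1)
open import Data.Nat.GCD using (gcd; module Bézout)
open import Data.Nat.LCM using (lcm-least; m∣lcm[m,n]; n∣lcm[m,n]; gcd*lcm)
open import Data.Nat.Primality using (Prime; prime⇒irreducible; ¬prime[1])
open import Data.Nat.Primality.Factorisation using (factorise; PrimeFactorisation)
open import Data.Nat.ListAction using (product)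
open import Data.Nat.Tactic.RingSolver using (solve-∀)
open import Data.List.Base using ([]; _∷_)
open import Data.List.Relation.Unary.All using (All; []; _∷_)
open import Data.Product using (_,_; proj₁; proj₂)
open import Data.Sum using (inj₁; inj₂)
open import Data.Empty using (⊥-elim)
open import Relation.Nullary using (¬_; yes; no)
open import Relation.Binary.PropositionalEquality
  using (refl; sym; trans; cong; cong₂; subst; module ≡-Reasoning)

positive-factors : ∀ s u → 1 ≤ s * u → 1 ≤ s × 1 ≤ u
positive-factors (suc s) (suc u) _ = s≤s z≤n , s≤s z≤n
positive-factors (suc s) zero p = ⊥-elim (1+n≰n (subst (1 ≤_) (*-zeroʳ s) p))

positive-factors-suc : ∀ s u {r} → s * u ≡ suc r → 1 ≤ s × 1 ≤ u
positive-factors-suc s u eq = positive-factors s u (subst (1 ≤_) (sym eq) (s≤s z≤n))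

prime-coprime : ∀ {p n} → Prime p → ¬ (p ∣ n) → Coprime p n
prime-coprime pr p∤n (d∣p , d∣n) with prime⇒irreducible pr d∣p
... | inj₁ d≡1 = d≡1
... | inj₂ refl = ⊥-elim (p∤n d∣n)

coprime-*ˡ : ∀ {a b c} → Coprime a c → Coprime b c → Coprime (a * b) c
coprime-*ˡ {a} ac bc {d} (d∣ab , d∣c) = bc (coprime-divisor d⊥a d∣ab , d∣c)
  where
  d⊥a : Coprime d a
  d⊥a (i∣d , i∣a) = ac (i∣a , ∣-trans i∣d d∣c)

lcm-coprime : ∀ {u v} → Coprime u v → lcm u v ≡ u * v
lcm-coprime {u} {v} cop = begin
  lcm u v             ≡⟨ sym (*-identityˡ (lcm u v)) ⟩
  1 * lcm u v         ≡⟨ cong (_* lcm u v) (sym (coprime⇒gcd≡1 cop)) ⟩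
  gcd u v * lcm u v   ≡⟨ gcd*lcm u v ⟩
  u * v               ∎
  where open ≡-Reasoning

LcmSplit : ℕ → ℕ → Set
LcmSplit x y = ∃[ u ] ∃[ v ] (u ∣ x × v ∣ y × Coprime u v × x ∣ u * v × y ∣ u * v)

lcmSplit⇒lcm : ∀ {x y u v} → u ∣ x → v ∣ y → Coprime u v → x ∣ u * v → y ∣ u * v →
               u * v ≡ lcm x y
lcmSplit⇒lcm {x} {y} u∣x v∣y cop x∣uv y∣uv = ∣-antisym
  (subst (_∣ lcm x y) (lcm-coprime cop)
    (lcm-least (∣-trans u∣x (m∣lcm[m,n] x y)) (∣-trans v∣y (n∣lcm[m,n] x y))))
  (lcm-least x∣uv y∣uv)

lcmSplit-∤ : ∀ {p x y} → Prime p → ¬ (p ∣ y) → LcmSplit x y → LcmSplit (p * x) y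
lcmSplit-∤ {p} {x} {y} pr p∤y (u , v , u∣x , v∣y , cop , x∣uv , y∣uv) =
  p * u , v , *-monoʳ-∣ p u∣x , v∣y ,
  coprime-*ˡ (prime-coprime pr (λ p∣v → p∤y (∣-trans p∣v v∣y))) cop ,
  subst (p * x ∣_) (sym (*-assoc p u v)) (*-monoʳ-∣ p x∣uv) ,
  subst (y ∣_) (sym (*-assoc p u v)) (∣n⇒∣m*n p y∣uv)

-- Adding a prime p to both x and y: it joins whichever side it already divides
-- (the y-side if p ∣ v, else the x-side), keeping the two sides coprime.
lcmSplit-∣ : ∀ {p x y} → Prime p → LcmSplit x y → LcmSplit (p * x) (y * p)
lcmSplit-∣ {p} {x} {y} pr (u , v , u∣x , v∣y , cop , x∣uv , y∣uv) with p ∣? v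
... | yes p∣v =
  u , p * v , ∣-trans u∣x (n∣m*n p) , subst (p * v ∣_) (*-comm p y) (*-monoʳ-∣ p v∣y) ,
  Coprime.sym (coprime-*ˡ (prime-coprime pr p∤u) (Coprime.sym cop)) ,
  subst (p * x ∣_) (rearrangeˡ p u v) (*-monoʳ-∣ p x∣uv) ,
  subst (y * p ∣_) (rearrangeʳ p u v) (*-monoˡ-∣ p y∣uv)
  where
  p∤u : ¬ (p ∣ u)
  p∤u p∣u = ¬prime[1] (subst Prime (cop (p∣u , p∣v)) pr)
  rearrangeˡ : ∀ p u v → p * (u * v) ≡ u * (p * v)
  rearrangeˡ = solve-∀
  rearrangeʳ : ∀ p u v → u * v * p ≡ u * (p * v)
  rearrangeʳ = solve-∀
... | no p∤v =
  p * u , v , *-monoʳ-∣ p u∣x , ∣-trans v∣y (m∣m*n p) ,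
  coprime-*ˡ (prime-coprime pr p∤v) cop ,
  subst (p * x ∣_) (sym (*-assoc p u v)) (*-monoʳ-∣ p x∣uv) ,
  subst (y * p ∣_) (rearrange p u v) (*-monoˡ-∣ p y∣uv)
  where
  rearrange : ∀ p u v → u * v * p ≡ p * u * v
  rearrange = solve-∀

lcmSplit-primes : ∀ ps → All Prime ps → ∀ y → LcmSplit (product ps) y
lcmSplit-primes [] _ y =
  1 , y , ∣-refl , ∣-refl , Coprime.1-coprimeTo y , 1∣ _ , ∣-reflexive (sym (*-identityˡ y))
lcmSplit-primes (p ∷ ps) (pr ∷ prs) y with p ∣? y
... | no p∤y = lcmSplit-∤ pr p∤y (lcmSplit-primes ps prs y)
... | yes (divides y′ refl) = lcmSplit-∣ pr (lcmSplit-primes ps prs y′)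

lcmSplit : ∀ x .{{_ : NonZero x}} y → LcmSplit x y
lcmSplit x y = subst (λ z → LcmSplit z y) (sym isFactorisation) (lcmSplit-primes factors factorsPrime y)
  where open PrimeFactorisation (factorise x)

-- Chinese-remainder idempotents for u, v: ε₁ = v * α is 1 modulo u (and 0 modulo v),
-- ε₂ = u * β is 1 modulo v (and 0 modulo u), and ε₁ + ε₂ is 1 modulo u * v.
CRT : ℕ → ℕ → Set
CRT u v = ∃[ α ] ∃[ β ] ((∃[ r ] v * α ≡ 1 + u * r) × (∃[ r ] u * β ≡ 1 + v * r)
                        × (∃[ q ] v * α + u * β ≡ 1 + u * v * q))

crt-sym : ∀ {u v} → CRT u v → CRT v u
crt-sym {u} {v} (α , β , ε₁ , ε₂ , q , sum) =
  β , α , ε₂ , ε₁ , q , trans (+-comm (u * β) (v * α)) (trans sum (cong (λ z → 1 + z * q) (*-comm u v)))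

-- The idempotent ε₁ = v * α ≡ 1 + u * r determines ε₂ = u * (v * (1 + r) ∸ r).
crt-complete : ∀ {u v α r} → 1 ≤ u → 1 ≤ v → v * α ≡ 1 + u * r → CRT u v
crt-complete {u} {v} {α} {r} u≥1 v≥1 ε₁ = α , β , (r , ε₁) , (r′ , ε₂) , (suc r , sum)
  where
  instance
    u≢0 : NonZero u
    u≢0 = >-nonZero u≥1
    v≢0 : NonZero v
    v≢0 = >-nonZero v≥1
  β r′ : ℕ
  β  = v * suc r ∸ r
  r′ = u * suc r ∸ α
  β+r : β + r ≡ v * suc r
  β+r = m∸n+n≡m (≤-trans (n≤1+n r) (m≤n*m (suc r) v))
  r′+α : r′ + α ≡ u * suc r
  r′+α = m∸n+n≡m (begin α ≤⟨ m≤n*m α v ⟩ v * α ≡⟨ ε₁ ⟩ 1 + u * r ≤⟨ +-monoˡ-≤ (u * r) u≥1 ⟩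
                           u + u * r ≡⟨ *-suc u r ⟨ u * suc r ∎)
    where open ≤-Reasoning
  uβ+ur : u * β + u * r ≡ u * v * suc r
  uβ+ur = trans (sym (*-distribˡ-+ u β r)) (trans (cong (u *_) β+r) (sym (*-assoc u v (suc r))))
  ε₂ : u * β ≡ 1 + v * r′
  ε₂ = +-cancelʳ-≡ (u * r) (u * β) (1 + v * r′) (begin
    u * β + u * r       ≡⟨ uβ+ur ⟩
    u * v * suc r       ≡⟨ cong (_* suc r) (*-comm u v) ⟩
    v * u * suc r       ≡⟨ *-assoc v u (suc r) ⟩
    v * (u * suc r)     ≡⟨ cong (v *_) r′+α ⟨
    v * (r′ + α)        ≡⟨ *-distribˡ-+ v r′ α ⟩
    v * r′ + v * α      ≡⟨ cong (v * r′ +_) ε₁ ⟩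
    v * r′ + (1 + u * r) ≡⟨ +-assoc (v * r′) 1 (u * r) ⟨
    v * r′ + 1 + u * r  ≡⟨ cong (_+ u * r) (+-comm (v * r′) 1) ⟩
    1 + v * r′ + u * r  ∎)
    where open ≡-Reasoning
  sum : v * α + u * β ≡ 1 + u * v * suc r
  sum = begin
    v * α + u * β        ≡⟨ cong (_+ u * β) ε₁ ⟩
    1 + u * r + u * β    ≡⟨ +-assoc 1 (u * r) (u * β) ⟩
    1 + (u * r + u * β)  ≡⟨ cong (1 +_) (trans (+-comm (u * r) (u * β)) uβ+ur) ⟩
    1 + u * v * suc r    ∎
    where open ≡-Reasoning

crt : ∀ {u v} → Coprime u v → 1 ≤ u → 1 ≤ v → CRT u v
crt {u} {v} cop u≥1 v≥1 with coprime-Bézout cop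
... | Bézout.-+ x y 1+xu≡yv = crt-complete u≥1 v≥1 (trans (*-comm v y) (trans (sym 1+xu≡yv) (cong (1 +_) (*-comm x u))))
... | Bézout.+- x y 1+yv≡xu = crt-sym {v} {u} (crt-complete v≥1 u≥1 (trans (*-comm u x) (trans (sym 1+yv≡xu) (cong (1 +_) (*-comm y v)))))

cofactor-divides : ∀ {s u n′} k v → 1 ≤ u → s * u ∣ k * n′ → n′ ∣ u * v → s ∣ k * v
cofactor-divides {s} {u} {n′} k v u≥1 su∣kn′ n′∣uv = *-cancelʳ-∣ u {{>-nonZero u≥1}}
  (subst (s * u ∣_) (regroup k u v) (∣-trans su∣kn′ (*-monoʳ-∣ k n′∣uv)))
  where
  regroup : ∀ k u v → k * (u * v) ≡ k * v * u
  regroup = solve-∀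

*-regroup : ∀ k v α γ s → k * v ≡ γ * s → k * (v * α) ≡ s * (γ * α)
*-regroup k v α γ s kv≡γs =
  trans (sym (*-assoc k v α)) (trans (cong (_* α) kv≡γs) (swap γ s α))
  where
  swap : ∀ γ s α → γ * s * α ≡ s * (γ * α)
  swap = solve-∀

^-distribʳ-* : ∀ x y n → (x * y) ^ n ≡ x ^ n * y ^ n
^-distribʳ-* x y zero = refl
^-distribʳ-* x y (suc n) = trans (cong (x * y *_) (^-distribʳ-* x y n)) (interchange x y (x ^ n) (y ^ n))
  where open import Algebra.Properties.CommutativeSemigroup *-commutativeSemigroup using (interchange)

module Modular (m : ℕ) .{{_ : NonZero m}} where

  open import Level using (0ℓ)
  open import Relation.Binary.Bundles using (Setoid)

  infix 4 _≈_
  _≈_ : ℕ → ℕ → Set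
  x ≈ y = x ≡ y [mod m ]

  ≈-setoid : Setoid 0ℓ 0ℓ
  ≈-setoid = record
    { Carrier = ℕ ; _≈_ = _≈_
    ; isEquivalence = record { refl = refl ; sym = sym ; trans = trans } }

  open Setoid ≈-setoid public using () renaming (refl to ≈-refl; sym to ≈-sym; trans to ≈-trans)
  open import Relation.Binary.Reasoning.Setoid ≈-setoid

  ≡⇒≈ : ∀ {x y} → x ≡ y → x ≈ y
  ≡⇒≈ = cong (_% m)

  *-cong : ∀ {a a′ b b′} → a ≈ a′ → b ≈ b′ → a * b ≈ a′ * b′
  *-cong {a} {a′} {b} {b′} a≈a′ b≈b′ =
    trans (%-distribˡ-* a b m) (trans (cong₂ (λ x y → x * y % m) a≈a′ b≈b′) (sym (%-distribˡ-* a′ b′ m)))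

  ^-cong : ∀ {a a′} n → a ≈ a′ → a ^ n ≈ a′ ^ n
  ^-cong zero    _    = ≈-refl
  ^-cong (suc n) a≈a′ = *-cong a≈a′ (^-cong n a≈a′)

  idem-pow : ∀ {y} → IdemMod m y → ∀ q → 1 ≤ q → y ^ q ≈ y
  idem-pow {y} _ 1 _ = ≡⇒≈ (*-identityʳ y)
  idem-pow {y} yy≈y (suc q@(suc _)) _ = begin
    y * y ^ q  ≈⟨ *-cong (≈-refl {y}) (idem-pow yy≈y q (s≤s z≤n)) ⟩
    y * y      ≈⟨ yy≈y ⟩
    y          ∎

  representative : ∀ x → ∃[ d ] (InZ m d × d ≈ x)
  representative x with x % m | m%n<n x m
  ... | zero  | _   = m , (>-nonZero⁻¹ m , ≤-refl) , n%n≡0 m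
  ... | suc r | r<m = suc r , (s≤s z≤n , <⇒≤ r<m) , m<n⇒m%n≡m r<m

  infix 4 _∈⟨_⟩
  _∈⟨_⟩ : ℕ → ℕ → Set
  x ∈⟨ D ⟩ = ∃[ t ] (1 ≤ t × x ≈ D ^ t)

  ∈⟨⟩-resp : ∀ {x y D} → x ≈ y → y ∈⟨ D ⟩ → x ∈⟨ D ⟩
  ∈⟨⟩-resp x≈y (t , t≥1 , y≈Dᵗ) = t , t≥1 , ≈-trans x≈y y≈Dᵗ

  ∈⟨⟩-gen-resp : ∀ {x D D′} → D ≈ D′ → x ∈⟨ D ⟩ → x ∈⟨ D′ ⟩
  ∈⟨⟩-gen-resp D≈D′ (t , t≥1 , x≈Dᵗ) = t , t≥1 , ≈-trans x≈Dᵗ (^-cong t D≈D′)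

  ∈⟨⟩-* : ∀ {x y D} → x ∈⟨ D ⟩ → y ∈⟨ D ⟩ → x * y ∈⟨ D ⟩
  ∈⟨⟩-* {x} {y} {D} (t , t≥1 , x≈Dᵗ) (t′ , _ , y≈Dᵗ′) = t + t′ , ≤-trans t≥1 (m≤m+n t t′) , (begin
    x * y          ≈⟨ *-cong x≈Dᵗ y≈Dᵗ′ ⟩
    D ^ t * D ^ t′ ≡⟨ ^-distribˡ-+-* D t t′ ⟨
    D ^ (t + t′)   ∎)

  ∈⟨⟩-^ : ∀ {x D} → x ∈⟨ D ⟩ → ∀ i → 1 ≤ i → x ^ i ∈⟨ D ⟩
  ∈⟨⟩-^ {x} {D} (t , t≥1 , x≈Dᵗ) i i≥1 = t * i , *-mono-≤ t≥1 i≥1 , (begin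
    x ^ i        ≈⟨ ^-cong i x≈Dᵗ ⟩
    (D ^ t) ^ i  ≡⟨ ^-*-assoc D t i ⟩
    D ^ (t * i)  ∎)

  module AroundIdempotent (e : ℕ) (e-idem : IdemMod m e) where

    -- Order x n : x lies in the maximal subgroup of (ℤ_m , ·) with identity e and
    -- has order n there; this is exactly x ∈ R_m^e with |x|_m = n.
    record Order (x n : ℕ) : Set where
      field
        positive : 1 ≤ n
        power≈e  : x ^ n ≈ e
        e-unit   : e * x ≈ x
        minimal  : ∀ k → 1 ≤ k → k < n → ¬ IdemMod m (x ^ k)

    ≈e⇒idem : ∀ {y} → y ≈ e → IdemMod m y
    ≈e⇒idem {y} y≈e = begin
      y * y  ≈⟨ *-cong y≈e y≈e ⟩
      e * e  ≈⟨ e-idem ⟩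
      e      ≈⟨ y≈e ⟨
      y      ∎

    module _ {x n} (X : Order x n) where
      open Order X

      private instance
        n≢0 : NonZero n
        n≢0 = >-nonZero positive

      e-unitʳ-pow : ∀ {j} → 1 ≤ j → x ^ j * e ≈ x ^ j
      e-unitʳ-pow {suc j} _ = begin
        x * x ^ j * e    ≡⟨ *-comm (x * x ^ j) e ⟩
        e * (x * x ^ j)  ≡⟨ *-assoc e x (x ^ j) ⟨
        e * x * x ^ j    ≈⟨ *-cong e-unit (≈-refl {x ^ j}) ⟩
        x * x ^ j        ∎

      periodic : ∀ {j d} → 1 ≤ j → n ∣ d → x ^ (j + d) ≈ x ^ j
      periodic {j} _ (divides zero refl) = ≡⇒≈ (cong (x ^_) (+-identityʳ j))
      periodic {j} j≥1 (divides q@(suc _) refl) = begin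
        x ^ (j + q * n)      ≡⟨ ^-distribˡ-+-* x j (q * n) ⟩
        x ^ j * x ^ (q * n)  ≡⟨ cong (λ z → x ^ j * x ^ z) (*-comm q n) ⟩
        x ^ j * x ^ (n * q)  ≡⟨ cong (x ^ j *_) (^-*-assoc x n q) ⟨
        x ^ j * (x ^ n) ^ q  ≈⟨ *-cong (≈-refl {x ^ j}) (^-cong q power≈e) ⟩
        x ^ j * e ^ q        ≈⟨ *-cong (≈-refl {x ^ j}) (idem-pow e-idem q (s≤s z≤n)) ⟩
        x ^ j * e            ≈⟨ e-unitʳ-pow j≥1 ⟩
        x ^ j                ∎

      multiple-power≈e : ∀ {d} → n ∣ d → 1 ≤ d → x ^ d ≈ e
      multiple-power≈e (divides q@(suc _) refl) _ = begin
        x ^ (q * n)  ≡⟨ cong (x ^_) (*-comm q n) ⟩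
        x ^ (n * q)  ≡⟨ ^-*-assoc x n q ⟨
        (x ^ n) ^ q  ≈⟨ ^-cong q power≈e ⟩
        e ^ q        ≈⟨ idem-pow e-idem q (s≤s z≤n) ⟩
        e            ∎

      order-divides : ∀ {i} → 1 ≤ i → x ^ i ≈ e → n ∣ i
      order-divides {i} _ xⁱ≈e with i % n | m≡m%n+[m/n]*n i n | m%n<n i n
      ... | zero  | i≡ | _   = divides (i / n) i≡
      ... | suc r | i≡ | r<n = ⊥-elim (minimal (suc r) (s≤s z≤n) r<n (≈e⇒idem xʳ≈e))
        where
        xʳ≈e : x ^ suc r ≈ e
        xʳ≈e = begin
          x ^ suc r                  ≈⟨ periodic {suc r} (s≤s z≤n) (n∣m*n (i / n)) ⟨
          x ^ (suc r + i / n * n)    ≡⟨ cong (x ^_) i≡ ⟨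
          x ^ i                      ≈⟨ xⁱ≈e ⟩
          e                          ∎

      reduce : ∀ t → 1 ≤ t → ∃[ t′ ] (1 ≤ t′ × t′ ≤ n × x ^ t ≈ x ^ t′)
      reduce t t≥1 with t % n | m≡m%n+[m/n]*n t n | m%n<n t n
      ... | zero  | t≡ | _   =
        n , positive , ≤-refl , ≈-trans (multiple-power≈e (divides (t / n) t≡) t≥1) (≈-sym power≈e)
      ... | suc r | t≡ | r<n =
        suc r , s≤s z≤n , <⇒≤ r<n , ≈-trans (≡⇒≈ (cong (x ^_) t≡)) (periodic {suc r} (s≤s z≤n) (n∣m*n (t / n)))

    Order-resp : ∀ {x x′ n} → x ≈ x′ → Order x n → Order x′ n
    Order-resp {x} {x′} {n} x≈x′ X = record
      { positive = positive
      ; power≈e  = ≈-trans (^-cong n (≈-sym x≈x′)) power≈e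
      ; e-unit   = ≈-trans (*-cong (≈-refl {e}) (≈-sym x≈x′)) (≈-trans e-unit x≈x′)
      ; minimal  = λ k k≥1 k<n x′ᵏ-idem → minimal k k≥1 k<n (begin
          x ^ k * x ^ k    ≈⟨ *-cong (^-cong k x≈x′) (^-cong k x≈x′) ⟩
          x′ ^ k * x′ ^ k  ≈⟨ x′ᵏ-idem ⟩
          x′ ^ k           ≈⟨ ^-cong k x≈x′ ⟨
          x ^ k            ∎)
      }
      where open Order X

    InRe⇒Order : ∀ {x n} → InRe m e x n → Order x n
    InRe⇒Order {x} {n} (_ , (n≥1 , _ , minimal) , xⁿ⁺¹≈x , xⁿ≈e) = record
      { positive = n≥1 ; power≈e = xⁿ≈e ; minimal = minimal
      ; e-unit = begin
          e * x        ≡⟨ *-comm e x ⟩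
          x * e        ≈⟨ *-cong (≈-refl {x}) xⁿ≈e ⟨
          x * x ^ n    ≈⟨ xⁿ⁺¹≈x ⟩
          x            ∎
      }

    Order⇒InRe : ∀ {x n} → InZ m x → Order x n → InRe m e x n
    Order⇒InRe {x} {n} x∈ℤₘ X =
      x∈ℤₘ , (positive , ≈e⇒idem power≈e , minimal) , xⁿ⁺¹≈x , power≈e
      where
      open Order X
      xⁿ⁺¹≈x : x ^ suc n ≈ x
      xⁿ⁺¹≈x = begin
        x * x ^ n  ≈⟨ *-cong (≈-refl {x}) power≈e ⟩
        x * e      ≡⟨ *-comm x e ⟩
        e * x      ≈⟨ e-unit ⟩
        x          ∎

    ∈⟨⟩-killed : ∀ {x D k} → x ∈⟨ D ⟩ → 1 ≤ k → D ^ k ≈ e → x ^ k ≈ e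
    ∈⟨⟩-killed {x} {D} {k} (t , t≥1 , x≈Dᵗ) _ Dᵏ≈e = begin
      x ^ k        ≈⟨ ^-cong k x≈Dᵗ ⟩
      (D ^ t) ^ k  ≡⟨ ^-*-assoc D t k ⟩
      D ^ (t * k)  ≡⟨ cong (D ^_) (*-comm t k) ⟩
      D ^ (k * t)  ≡⟨ ^-*-assoc D k t ⟨
      (D ^ k) ^ t  ≈⟨ ^-cong t Dᵏ≈e ⟩
      e ^ t        ≈⟨ idem-pow e-idem t t≥1 ⟩
      e            ∎

    ∈⟨⟩⇒orbit : ∀ {a d n} → Order d n → a ∈⟨ d ⟩ → InOrb m a d n
    ∈⟨⟩⇒orbit Od (t , t≥1 , a≈dᵗ) with reduce Od t t≥1
    ... | t′ , t′≥1 , t′≤n , dᵗ≈dᵗ′ = t′ , t′≥1 , t′≤n , ≈-trans a≈dᵗ dᵗ≈dᵗ′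

    common-power-divides : ∀ {x y n n′ k j} → Order x n → Order y n′ → 1 ≤ k → 1 ≤ j →
                           x ^ k ≈ y ^ j → n ∣ k * n′
    common-power-divides {x} {y} {n} {n′} {k} {j} X Y k≥1 j≥1 xᵏ≈yʲ =
      order-divides X (*-mono-≤ k≥1 (Order.positive Y)) (begin
        x ^ (k * n′)  ≡⟨ ^-*-assoc x k n′ ⟨
        (x ^ k) ^ n′  ≈⟨ ^-cong n′ xᵏ≈yʲ ⟩
        (y ^ j) ^ n′  ≡⟨ ^-*-assoc y j n′ ⟩
        y ^ (j * n′)  ≈⟨ multiple-power≈e Y (n∣m*n j) (*-mono-≤ j≥1 (Order.positive Y)) ⟩
        e             ∎)

    projection : ∀ {x y s u w v α r} → Order x (s * u) → Order y (w * v) → 1 ≤ s →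
                 v * α ≡ 1 + u * r → (x ^ s * y ^ w) ^ (v * α) ≈ x ^ s
    projection {x} {y} {s} {u} {w} {v} {α} {r} X Y s≥1 ε₁ = begin
      (x ^ s * y ^ w) ^ (v * α)              ≡⟨ ^-distribʳ-* (x ^ s) (y ^ w) (v * α) ⟩
      (x ^ s) ^ (v * α) * (y ^ w) ^ (v * α)  ≡⟨ cong₂ _*_ (^-*-assoc x s (v * α)) (^-*-assoc y w (v * α)) ⟩
      x ^ (s * (v * α)) * y ^ (w * (v * α))  ≡⟨ cong₂ (λ i j → x ^ i * y ^ j) x-exponent (sym (*-assoc w v α)) ⟩
      x ^ (s + s * (u * r)) * y ^ (w * v * α)
        ≈⟨ *-cong (periodic X s≥1 (*-monoʳ-∣ s (m∣m*n r)))
                  (multiple-power≈e Y (m∣m*n α) (*-mono-≤ (Order.positive Y) α≥1)) ⟩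
      x ^ s * e                              ≈⟨ e-unitʳ-pow X s≥1 ⟩
      x ^ s                                  ∎
      where
      α≥1 : 1 ≤ α
      α≥1 = proj₂ (positive-factors-suc v α ε₁)
      x-exponent : s * (v * α) ≡ s + s * (u * r)
      x-exponent = trans (cong (s *_) ε₁) (trans (*-distribˡ-+ s 1 (u * r)) (cong (_+ s * (u * r)) (*-identityʳ s)))

    module CoprimeProduct {b c s u w v} (B : Order b (s * u)) (C : Order c (w * v))
                          (u⊥v : Coprime u v) where

      D : ℕ
      D = b ^ s * c ^ w

      s≥1 : 1 ≤ s
      s≥1 = proj₁ (positive-factors s u (Order.positive B))
      u≥1 : 1 ≤ u
      u≥1 = proj₂ (positive-factors s u (Order.positive B))
      w≥1 : 1 ≤ w
      w≥1 = proj₁ (positive-factors w v (Order.positive C))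
      v≥1 : 1 ≤ v
      v≥1 = proj₂ (positive-factors w v (Order.positive C))

      -- Both factors b^s and c^w are powers of D (projections along the CRT idempotents).
      b^s∈⟨D⟩ : b ^ s ∈⟨ D ⟩
      b^s∈⟨D⟩ with crt u⊥v u≥1 v≥1
      ... | α , _ , (r , ε₁) , _ =
        v * α , subst (1 ≤_) (sym ε₁) (s≤s z≤n) , ≈-sym (projection {w = w} {v = v} {α = α} B C s≥1 ε₁)

      c^w∈⟨D⟩ : c ^ w ∈⟨ D ⟩
      c^w∈⟨D⟩ with crt u⊥v u≥1 v≥1
      ... | _ , β , _ , (r′ , ε₂) , _ =
        u * β , subst (1 ≤_) (sym ε₂) (s≤s z≤n) ,
        ≈-trans (≈-sym (projection {w = s} {v = u} {α = β} C B w≥1 ε₂)) (≡⇒≈ (cong (_^ (u * β)) (*-comm (c ^ w) (b ^ s))))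

      D-power≈e : D ^ (u * v) ≈ e
      D-power≈e = begin
        (b ^ s * c ^ w) ^ (u * v)                  ≡⟨ ^-distribʳ-* (b ^ s) (c ^ w) (u * v) ⟩
        (b ^ s) ^ (u * v) * (c ^ w) ^ (u * v)      ≡⟨ cong₂ _*_ (^-*-assoc b s (u * v)) (^-*-assoc c w (u * v)) ⟩
        b ^ (s * (u * v)) * c ^ (w * (u * v))
          ≈⟨ *-cong (multiple-power≈e B (*-monoʳ-∣ s (m∣m*n v)) (*-mono-≤ s≥1 uv≥1))
                    (multiple-power≈e C (*-monoʳ-∣ w (n∣m*n u)) (*-mono-≤ w≥1 uv≥1)) ⟩
        e * e                                      ≈⟨ e-idem ⟩
        e                                          ∎
        where
        uv≥1 : 1 ≤ u * v
        uv≥1 = *-mono-≤ u≥1 v≥1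

      D-killer-divides : ∀ {k} → 1 ≤ k → D ^ k ≈ e → u * v ∣ k
      D-killer-divides {k} k≥1 Dᵏ≈e =
        subst (_∣ k) (lcm-coprime u⊥v) (lcm-least (factor-divides B s≥1 b^s∈⟨D⟩) (factor-divides C w≥1 c^w∈⟨D⟩))
        where
        factor-divides : ∀ {x s u} → Order x (s * u) → 1 ≤ s → x ^ s ∈⟨ D ⟩ → u ∣ k
        factor-divides {x} {s} X s≥1 xˢ∈⟨D⟩ = *-cancelˡ-∣ s {{>-nonZero s≥1}}
          (order-divides X (*-mono-≤ s≥1 k≥1)
            (≈-trans (≡⇒≈ (sym (^-*-assoc x s k))) (∈⟨⟩-killed xˢ∈⟨D⟩ k≥1 Dᵏ≈e)))

      D-order : Order D (u * v)
      D-order = record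
        { positive = *-mono-≤ u≥1 v≥1
        ; power≈e  = D-power≈e
        ; e-unit   = begin
            e * (b ^ s * c ^ w)  ≡⟨ *-assoc e (b ^ s) (c ^ w) ⟨
            e * b ^ s * c ^ w    ≡⟨ cong (_* c ^ w) (*-comm e (b ^ s)) ⟩
            b ^ s * e * c ^ w    ≈⟨ *-cong (e-unitʳ-pow B s≥1) (≈-refl {c ^ w}) ⟩
            b ^ s * c ^ w        ∎
        ; minimal  = λ k k≥1 k<uv Dᵏ-idem →
            <⇒≱ k<uv (∣⇒≤ {{>-nonZero k≥1}} (D-killer-divides k≥1 (idempotent-power≈e k k≥1 Dᵏ-idem)))
        }
        where
        -- An idempotent power of D is e, since it equals its own (u * v)-th power.
        idempotent-power≈e : ∀ k → 1 ≤ k → IdemMod m (D ^ k) → D ^ k ≈ e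
        idempotent-power≈e k k≥1 Dᵏ-idem = begin
          D ^ k                ≈⟨ idem-pow Dᵏ-idem (u * v) (*-mono-≤ u≥1 v≥1) ⟨
          (D ^ k) ^ (u * v)    ≡⟨ ^-*-assoc D k (u * v) ⟩
          D ^ (k * (u * v))    ≡⟨ cong (D ^_) (*-comm k (u * v)) ⟩
          D ^ (u * v * k)      ≡⟨ ^-*-assoc D (u * v) k ⟨
          (D ^ (u * v)) ^ k    ≈⟨ ^-cong k D-power≈e ⟩
          e ^ k                ≈⟨ idem-pow e-idem k k≥1 ⟩
          e                    ∎

      -- A common power a ≈ b^k ≈ c^j lies in ⟨ D ⟩: split a ≈ a^ε₁ * a^ε₂ along the CRT
      -- idempotents ε₁ = v * α, ε₂ = u * β; then a^ε₁ is a power of b^s, a^ε₂ one of c^w.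
      common-power∈⟨D⟩ : ∀ {a k j} → s * u ∣ u * v → w * v ∣ u * v → 1 ≤ k → 1 ≤ j →
                         a ≈ b ^ k → b ^ k ≈ c ^ j → a ∈⟨ D ⟩
      common-power∈⟨D⟩ {a} {k} {j} su∣uv wv∣uv k≥1 j≥1 a≈bᵏ bᵏ≈cʲ
        with crt u⊥v u≥1 v≥1
           | cofactor-divides k v u≥1 (common-power-divides B C k≥1 j≥1 bᵏ≈cʲ) wv∣uv
           | cofactor-divides j u v≥1 (common-power-divides C B j≥1 k≥1 (≈-sym bᵏ≈cʲ))
                                  (subst (s * u ∣_) (*-comm u v) su∣uv)
      ... | α , β , (r , ε₁) , (r′ , ε₂) , (q , ε₁+ε₂) | divides γ kv≡γs | divides δ ju≡δw =
        ∈⟨⟩-resp a≈split (∈⟨⟩-* (∈⟨⟩-^ b^s∈⟨D⟩ (γ * α) γα≥1) (∈⟨⟩-^ c^w∈⟨D⟩ (δ * β) δβ≥1))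
        where
        γα≥1 : 1 ≤ γ * α
        γα≥1 = *-mono-≤ (proj₁ (positive-factors γ s (subst (1 ≤_) kv≡γs (*-mono-≤ k≥1 v≥1))))
                        (proj₂ (positive-factors-suc v α ε₁))
        δβ≥1 : 1 ≤ δ * β
        δβ≥1 = *-mono-≤ (proj₁ (positive-factors δ w (subst (1 ≤_) ju≡δw (*-mono-≤ j≥1 u≥1))))
                        (proj₂ (positive-factors-suc u β ε₂))
        exponent : k * (v * α + u * β) ≡ k + k * (u * v * q)
        exponent = trans (cong (k *_) ε₁+ε₂)
                         (trans (*-distribˡ-+ k 1 (u * v * q)) (cong (_+ k * (u * v * q)) (*-identityʳ k)))
        a≈split : a ≈ (b ^ s) ^ (γ * α) * (c ^ w) ^ (δ * β)
        a≈split = begin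
          a                                      ≈⟨ a≈bᵏ ⟩
          b ^ k                                  ≈⟨ periodic B k≥1 (∣-trans su∣uv (∣-trans (m∣m*n q) (n∣m*n k))) ⟨
          b ^ (k + k * (u * v * q))              ≡⟨ cong (b ^_) exponent ⟨
          b ^ (k * (v * α + u * β))              ≡⟨ cong (b ^_) (*-distribˡ-+ k (v * α) (u * β)) ⟩
          b ^ (k * (v * α) + k * (u * β))        ≡⟨ ^-distribˡ-+-* b (k * (v * α)) (k * (u * β)) ⟩
          b ^ (k * (v * α)) * b ^ (k * (u * β))  ≡⟨ cong (b ^ (k * (v * α)) *_) (^-*-assoc b k (u * β)) ⟨
          b ^ (k * (v * α)) * (b ^ k) ^ (u * β)  ≈⟨ *-cong (≈-refl {b ^ (k * (v * α))}) (^-cong (u * β) bᵏ≈cʲ) ⟩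
          b ^ (k * (v * α)) * (c ^ j) ^ (u * β)  ≡⟨ cong (b ^ (k * (v * α)) *_) (^-*-assoc c j (u * β)) ⟩
          b ^ (k * (v * α)) * c ^ (j * (u * β))  ≡⟨ cong₂ (λ i i′ → b ^ i * c ^ i′) (*-regroup k v α γ s kv≡γs) (*-regroup j u β δ w ju≡δw) ⟩
          b ^ (s * (γ * α)) * c ^ (w * (δ * β))  ≡⟨ cong₂ _*_ (^-*-assoc b s (γ * α)) (^-*-assoc c w (δ * β)) ⟨
          (b ^ s) ^ (γ * α) * (c ^ w) ^ (δ * β)  ∎

    lcm-order-element : ∀ {a b c nb nc k j} → Order b nb → Order c nc → 1 ≤ k → 1 ≤ j →
                        a ≈ b ^ k → a ≈ c ^ j →
                        ∃[ d ] (InZ m d × Order d (lcm nb nc) × InOrb m a d (lcm nb nc))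
    lcm-order-element {a} {b} {c} {nb} {nc} B C k≥1 j≥1 a≈bᵏ a≈cʲ
      with lcmSplit nb {{>-nonZero (Order.positive B)}} nc
    ... | u , v , u∣nb@(divides s nb≡su) , v∣nc@(divides w nc≡wv) , u⊥v , nb∣uv , nc∣uv =
      d , d∈ℤₘ , subst (Order d) uv≡lcm d-order , subst (InOrb m a d) uv≡lcm (∈⟨⟩⇒orbit d-order a∈⟨d⟩)
      where
      open CoprimeProduct {s = s} {w = w} (subst (Order b) nb≡su B) (subst (Order c) nc≡wv C) u⊥v
      uv≡lcm : u * v ≡ lcm nb nc
      uv≡lcm = lcmSplit⇒lcm u∣nb v∣nc u⊥v nb∣uv nc∣uv
      d : ℕ
      d = proj₁ (representative D)
      d∈ℤₘ : InZ m d
      d∈ℤₘ = proj₁ (proj₂ (representative D))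
      D≈d : D ≈ d
      D≈d = ≈-sym (proj₂ (proj₂ (representative D)))
      d-order : Order d (u * v)
      d-order = Order-resp D≈d D-order
      a∈⟨d⟩ : a ∈⟨ d ⟩
      a∈⟨d⟩ = ∈⟨⟩-gen-resp D≈d (common-power∈⟨D⟩ (subst (_∣ u * v) nb≡su nb∣uv) (subst (_∣ u * v) nc≡wv nc∣uv)
                                  k≥1 j≥1 a≈bᵏ (≈-trans (≈-sym a≈bᵏ) a≈cʲ))

open Modular using (module AroundIdempotent)
open AroundIdempotent using (InRe⇒Order; Order⇒InRe; lcm-order-element)

theorem2p18 : (m : ℕ) → .{{_ : NonZero m}} → (e a b c na nb nc : ℕ) →
    InE m e → InRe m e a na → InRe m e b nb → InRe m e c nc →
    InOrb m a b nb → InOrb m a c nc →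
    ∃[ d ] ∃[ nd ] (InRe m e d nd × InOrb m a d nd × nd ≡ lcm nb nc)
theorem2p18 m e a b c na nb nc (_ , e-idem) _ b∈Rₘᵉ c∈Rₘᵉ (k , k≥1 , _ , a≈bᵏ) (j , j≥1 , _ , a≈cʲ) =
  let d , d∈ℤₘ , d-order , a∈Orb[d] = lcm-order-element m e e-idem
                                        (InRe⇒Order m e e-idem b∈Rₘᵉ) (InRe⇒Order m e e-idem c∈Rₘᵉ)
                                        k≥1 j≥1 a≈bᵏ a≈cʲ
  in d , lcm nb nc , Order⇒InRe m e e-idem d∈ℤₘ d-order , a∈Orb[d] , refl
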